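{- Define integers $b_{\mathcal{G}}(n)$, $n\ge0$, by $b_{\mathcal{G}}(0)=1$, $b_{\mathcal{G}}(1)=-1$, $b_{\mathcal{G}}(2)=-1$ and, for $n\ge 3$, $$b_{\mathcal{G}}(n)=-\frac12\left(\sum_{k=0}^{n-2}b_{\mathcal{G}}(k)\binom{n}{k+1}+\sum_{k=0}^{n-1}b_{\mathcal{G}}(k)\binom{n+1}{k+1}\right).$$ Let $\widetilde{G}(x)=x\frac{e^x-1}{e^x+1}=x\tanh(x/2)$. Then $\widetilde{G}^{(2n-1)}(0)=0$ and $\widetilde{G}^{(2n)}(0)=b_{\mathcal{G}}(2n-2)$ for all $n\ge 1$. -}

module Defs where

open import Data.Nat as ℕ using (ℕ; zero; suc; _∸_; _≤ᵇ_; _!)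
open import Data.Nat.Properties using (_!≢0)
open import Data.Nat.Combinatorics using (_C_)
open import Data.Integer using (+_)
open import Data.Rational using (ℚ; 0ℚ; 1ℚ; _+_; _*_; _-_; -_; _/_; 1/_; ½; NonZero)
open import Data.Bool using (if_then_else_)

ℕ→ℚ : ℕ → ℚ
ℕ→ℚ n = + n / 1

Σ< : ℕ → (ℕ → ℚ) → ℚ
Σ< zero    f = 0ℚ
Σ< (suc n) f = Σ< n f + f n

-- The sequence b_G(n), computed in ℚ (the paper's halving is exact).
-- bTable n k = b_G(k) for all k ≤ n.

bStep : ℕ → (ℕ → ℚ) → ℚ
bStep 0 t = 1ℚ
bStep 1 t = - 1ℚ
bStep 2 t = - 1ℚ
bStep n@(suc (suc (suc _))) t =
  - (½ * ( Σ< (n ∸ 1) (λ k → t k * ℕ→ℚ (n C suc k))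
         + Σ< n       (λ k → t k * ℕ→ℚ (suc n C suc k))))

bTable : ℕ → ℕ → ℚ
bTable zero    = λ _ → bStep 0 (λ _ → 0ℚ)
bTable (suc n) = λ k → if k ≤ᵇ n then bTable n k else bStep (suc n) (bTable n)

bG : ℕ → ℚ
bG n = bTable n n

-- Formal power series over ℚ: f n is the coefficient of x^n.

FPS : Set
FPS = ℕ → ℚ

_⊕_ : FPS → FPS → FPS
(f ⊕ g) n = f n + g n

_⊖_ : FPS → FPS → FPS
(f ⊖ g) n = f n - g n

_⊛_ : FPS → FPS → FPS
(f ⊛ g) n = Σ< (suc n) (λ k → f k * g (n ∸ k))

oneS : FPS
oneS zero    = 1ℚ
oneS (suc _) = 0ℚ

X : FPS
X 1 = 1ℚ
X _ = 0ℚ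

expS : FPS
expS n = + 1 / (n !) where instance _ = n !≢0

invTable : (f : FPS) → .{{NonZero (f 0)}} → ℕ → ℕ → ℚ
invTable f zero    = λ _ → 1/ (f 0)
invTable f (suc n) = λ k → if k ≤ᵇ n then invTable f n k
  else - (1/ (f 0) * Σ< (suc n) (λ j → invTable f n j * f (suc n ∸ j)))

invS : (f : FPS) → .{{NonZero (f 0)}} → FPS
invS f n = invTable f n n

D : FPS → FPS
D f n = ℕ→ℚ (suc n) * f (suc n)

iterD : ℕ → FPS → FPS
iterD zero    f = f
iterD (suc m) f = D (iterD m f)

derivAt0 : ℕ → FPS → ℚ
derivAt0 m f = iterD m f 0

expPlus1 : FPS
expPlus1 = expS ⊕ oneS

Gt : FPS
Gt = (X ⊛ (expS ⊖ oneS)) ⊛ invS expPlus1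

-- G̃(x) = x(eˣ − 1)/(eˣ + 1) is the quotient of two series u with u(x) = eˣ·u(−x),
-- so G̃ is even and its odd derivatives at 0 vanish. Write g(n) = G̃⁽ⁿ⁾(0).
-- Multiplying an exponential generating function by eˣ is the binomial transform
-- of its coefficients, so G̃·(eˣ + 1) = x(eˣ − 1) reads Σₖ C(n,k) g(k) + g(n) = n
-- for n ≥ 2. Two applications of Pascal's rule turn this into
-- β(m+1) − β(m) = −(S(m+1) + S(m+2)) for β(n) = g(n+2) + g(n+3) and
-- S(n) = Σ_{k<n} β(k) C(n,k+1), which is equivalent to the defining recurrence of b_G.
-- Hence b_G = β, and β(2n−2) = g(2n) since g(2n+1) = 0.

module Submission where

open import Defs
open import Data.Bool using (true; false; if_then_else_)
open import Data.Empty using (⊥-elim)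
import Data.Integer as ℤ
import Data.Integer.Properties as ℤₚ
import Data.Nat as ℕ
open import Data.Nat using (ℕ; zero; suc; _∸_; _≤ᵇ_; _!)
open import Data.Nat.Combinatorics using (_C_; nCk≡n!/k![n-k]!; k>n⇒nCk≡0; nCn≡1; nCk+nC[k+1]≡[n+1]C[k+1]; k![n∸k]!∣n!)
open import Data.Nat.DivMod using (m/n*n≡m)
open import Data.Nat.Induction using (<-rec)
import Data.Nat.Properties as ℕₚ
open import Data.Nat.Properties using (_!≢0; _!*_!≢0)
open import Data.Product using (_×_; _,_)
open import Data.Rational using (ℚ; 0ℚ; 1ℚ; _+_; _*_; _-_; -_; _/_; 1/_; ½; NonZero; toℚᵘ)
open import Data.Rational.Properties
open import Data.Rational.Solver using (module +-*-Solver)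
import Data.Rational.Unnormalised as ℚᵘ
import Data.Rational.Unnormalised.Properties as ℚᵘₚ
open import Data.Sum using (inj₁; inj₂)
open import Relation.Binary.PropositionalEquality
open +-*-Solver

toℚᵘ-ℕ→ℚ : ∀ n → toℚᵘ (ℕ→ℚ n) ℚᵘ.≃ ℚᵘ.mkℚᵘ (ℤ.+ n) 0
toℚᵘ-ℕ→ℚ n = toℚᵘ-fromℚᵘ (ℚᵘ.mkℚᵘ (ℤ.+ n) 0)

ℕ→ℚ-+ : ∀ m n → ℕ→ℚ (m ℕ.+ n) ≡ ℕ→ℚ m + ℕ→ℚ n
ℕ→ℚ-+ m n = toℚᵘ-injective (begin
  toℚᵘ (ℕ→ℚ (m ℕ.+ n))                       ≈⟨ toℚᵘ-ℕ→ℚ (m ℕ.+ n) ⟩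
  ℚᵘ.mkℚᵘ (ℤ.+ (m ℕ.+ n)) 0                  ≈⟨ ℚᵘ.*≡* (cong (ℤ._* ℤ.+ 1) numerators) ⟩
  ℚᵘ.mkℚᵘ (ℤ.+ m) 0 ℚᵘ.+ ℚᵘ.mkℚᵘ (ℤ.+ n) 0   ≈⟨ ℚᵘₚ.+-cong (toℚᵘ-ℕ→ℚ m) (toℚᵘ-ℕ→ℚ n) ⟨
  toℚᵘ (ℕ→ℚ m) ℚᵘ.+ toℚᵘ (ℕ→ℚ n)             ≈⟨ toℚᵘ-homo-+ (ℕ→ℚ m) (ℕ→ℚ n) ⟨
  toℚᵘ (ℕ→ℚ m + ℕ→ℚ n)                       ∎)
  where
  open ℚᵘₚ.≃-Reasoning
  numerators : ℤ.+ (m ℕ.+ n) ≡ ℤ.+ m ℤ.* ℤ.+ 1 ℤ.+ ℤ.+ n ℤ.* ℤ.+ 1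
  numerators = trans (ℤₚ.pos-+ m n) (sym (cong₂ ℤ._+_ (ℤₚ.*-identityʳ (ℤ.+ m)) (ℤₚ.*-identityʳ (ℤ.+ n))))

ℕ→ℚ-* : ∀ m n → ℕ→ℚ (m ℕ.* n) ≡ ℕ→ℚ m * ℕ→ℚ n
ℕ→ℚ-* m n = toℚᵘ-injective (begin
  toℚᵘ (ℕ→ℚ (m ℕ.* n))                       ≈⟨ toℚᵘ-ℕ→ℚ (m ℕ.* n) ⟩
  ℚᵘ.mkℚᵘ (ℤ.+ (m ℕ.* n)) 0                  ≈⟨ ℚᵘ.*≡* (cong (ℤ._* ℤ.+ 1) (ℤₚ.pos-* m n)) ⟩
  ℚᵘ.mkℚᵘ (ℤ.+ m) 0 ℚᵘ.* ℚᵘ.mkℚᵘ (ℤ.+ n) 0   ≈⟨ ℚᵘₚ.*-cong (toℚᵘ-ℕ→ℚ m) (toℚᵘ-ℕ→ℚ n) ⟨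
  toℚᵘ (ℕ→ℚ m) ℚᵘ.* toℚᵘ (ℕ→ℚ n)             ≈⟨ toℚᵘ-homo-* (ℕ→ℚ m) (ℕ→ℚ n) ⟨
  toℚᵘ (ℕ→ℚ m * ℕ→ℚ n)                       ∎)
  where open ℚᵘₚ.≃-Reasoning

ℕ→ℚ-*-inverseʳ : ∀ d .{{_ : ℕ.NonZero d}} → ℕ→ℚ d * (ℤ.+ 1 / d) ≡ 1ℚ
ℕ→ℚ-*-inverseʳ (suc d) = toℚᵘ-injective (begin
  toℚᵘ (ℕ→ℚ (suc d) * (ℤ.+ 1 / suc d))            ≈⟨ toℚᵘ-homo-* (ℕ→ℚ (suc d)) (ℤ.+ 1 / suc d) ⟩
  toℚᵘ (ℕ→ℚ (suc d)) ℚᵘ.* toℚᵘ (ℤ.+ 1 / suc d)    ≈⟨ ℚᵘₚ.*-cong (toℚᵘ-ℕ→ℚ (suc d))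
                                                                  (toℚᵘ-fromℚᵘ (ℚᵘ.mkℚᵘ (ℤ.+ 1) d)) ⟩
  ℚᵘ.mkℚᵘ (ℤ.+ suc d) 0 ℚᵘ.* ℚᵘ.mkℚᵘ (ℤ.+ 1) d   ≈⟨ ℚᵘ.*≡* crossMultiplied ⟩
  toℚᵘ 1ℚ                                         ∎)
  where
  open ℚᵘₚ.≃-Reasoning
  crossMultiplied : (ℤ.+ suc d ℤ.* ℤ.+ 1) ℤ.* ℤ.+ 1 ≡ ℤ.+ 1 ℤ.* ℤ.+ (1 ℕ.* suc d)
  crossMultiplied = trans (ℤₚ.*-identityʳ _) (trans (ℤₚ.*-identityʳ _)
    (trans (cong ℤ.+_ (sym (ℕₚ.*-identityˡ (suc d)))) (sym (ℤₚ.*-identityˡ _))))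

ℕ→ℚ-*-cancelˡ : ∀ d .{{_ : ℕ.NonZero d}} {x y : ℚ} → ℕ→ℚ d * x ≡ ℕ→ℚ d * y → x ≡ y
ℕ→ℚ-*-cancelˡ d {x} {y} eq = begin
  x                           ≡⟨ unscale x ⟨
  (ℤ.+ 1 / d) * (ℕ→ℚ d * x)   ≡⟨ cong ((ℤ.+ 1 / d) *_) eq ⟩
  (ℤ.+ 1 / d) * (ℕ→ℚ d * y)   ≡⟨ unscale y ⟩
  y                           ∎
  where
  open ≡-Reasoning
  unscale : ∀ z → (ℤ.+ 1 / d) * (ℕ→ℚ d * z) ≡ z
  unscale z = begin
    (ℤ.+ 1 / d) * (ℕ→ℚ d * z)   ≡⟨ solve 3 (λ e n z → e :* (n :* z) := (n :* e) :* z) refl (ℤ.+ 1 / d) (ℕ→ℚ d) z ⟩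
    (ℕ→ℚ d * (ℤ.+ 1 / d)) * z   ≡⟨ cong (_* z) (ℕ→ℚ-*-inverseʳ d) ⟩
    1ℚ * z                      ≡⟨ *-identityˡ z ⟩
    z                           ∎

+-move : ∀ {x y z : ℚ} → x + y ≡ z → y ≡ z - x
+-move {x} {y} eq = trans (solve 2 (λ x y → y := (x :+ y) :- x) refl x y) (cong (_- x) eq)

-1*x≡x⇒x≡0 : ∀ {x : ℚ} → - 1ℚ * x ≡ x → x ≡ 0ℚ
-1*x≡x⇒x≡0 {x} eq = begin
  x                     ≡⟨ solve 1 (λ x → x := con ½ :* (x :+ x)) refl x ⟩
  ½ * (x + x)           ≡⟨ cong (λ z → ½ * (x + z)) eq ⟨
  ½ * (x + - 1ℚ * x)    ≡⟨ solve 1 (λ x → con ½ :* (x :+ (:- con 1ℚ) :* x) := con 0ℚ) refl x ⟩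
  0ℚ                    ∎
  where open ≡-Reasoning

Σ<-cong : ∀ n {f g : ℕ → ℚ} → (∀ k → k ℕ.< n → f k ≡ g k) → Σ< n f ≡ Σ< n g
Σ<-cong zero    eq = refl
Σ<-cong (suc n) eq = cong₂ _+_ (Σ<-cong n (λ k k<n → eq k (ℕₚ.m<n⇒m<1+n k<n))) (eq n (ℕₚ.n<1+n n))

Σ<-+ : ∀ n (f g : ℕ → ℚ) → Σ< n (λ k → f k + g k) ≡ Σ< n f + Σ< n g
Σ<-+ zero    f g = refl
Σ<-+ (suc n) f g = trans (cong (_+ (f n + g n)) (Σ<-+ n f g))
  (solve 4 (λ a b c d → (a :+ b) :+ (c :+ d) := (a :+ c) :+ (b :+ d)) refl (Σ< n f) (Σ< n g) (f n) (g n))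

Σ<-*ˡ : ∀ n (c : ℚ) (f : ℕ → ℚ) → c * Σ< n f ≡ Σ< n (λ k → c * f k)
Σ<-*ˡ zero    c f = *-zeroʳ c
Σ<-*ˡ (suc n) c f = trans (*-distribˡ-+ c (Σ< n f) (f n)) (cong (_+ c * f n) (Σ<-*ˡ n c f))

Σ<-*ʳ : ∀ n (c : ℚ) (f : ℕ → ℚ) → Σ< n f * c ≡ Σ< n (λ k → f k * c)
Σ<-*ʳ n c f = trans (*-comm (Σ< n f) c) (trans (Σ<-*ˡ n c f) (Σ<-cong n (λ k _ → *-comm c (f k))))

Σ<-neg : ∀ n (f : ℕ → ℚ) → Σ< n (λ k → - f k) ≡ - Σ< n f
Σ<-neg zero    f = refl
Σ<-neg (suc n) f = trans (cong (_+ - f n) (Σ<-neg n f)) (sym (neg-distrib-+ (Σ< n f) (f n)))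

Σ<-0 : ∀ n → Σ< n (λ _ → 0ℚ) ≡ 0ℚ
Σ<-0 zero    = refl
Σ<-0 (suc n) = cong (_+ 0ℚ) (Σ<-0 n)

Σ<-head : ∀ n (f : ℕ → ℚ) → Σ< (suc n) f ≡ f 0 + Σ< n (λ k → f (suc k))
Σ<-head zero    f = trans (+-identityˡ (f 0)) (sym (+-identityʳ (f 0)))
Σ<-head (suc n) f = trans (cong (_+ f (suc n)) (Σ<-head n f)) (+-assoc (f 0) _ (f (suc n)))

Σ<-reverse : ∀ n (f : ℕ → ℚ) → Σ< n f ≡ Σ< n (λ k → f (n ∸ suc k))
Σ<-reverse zero    f = refl
Σ<-reverse (suc n) f = begin
  Σ< n f + f n                           ≡⟨ +-comm (Σ< n f) (f n) ⟩
  f n + Σ< n f                           ≡⟨ cong (λ z → f n + z) (Σ<-reverse n f) ⟩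
  f n + Σ< n (λ k → f (n ∸ suc k))       ≡⟨ Σ<-head n (λ k → f (n ∸ k)) ⟨
  Σ< (suc n) (λ k → f (n ∸ k))           ∎
  where open ≡-Reasoning

Σ<-triangle : ∀ n (F : ℕ → ℕ → ℚ) →
  Σ< (suc n) (λ k → Σ< (suc k) (λ j → F j k)) ≡ Σ< (suc n) (λ j → Σ< (suc (n ∸ j)) (λ i → F j (j ℕ.+ i)))
Σ<-triangle zero    F = refl
Σ<-triangle (suc n) F = begin
  Σ< (suc n) (λ k → Σ< (suc k) (λ j → F j k)) + Σ< (suc (suc n)) (λ j → F j (suc n))
    ≡⟨ cong (_+ Σ< (suc (suc n)) (λ j → F j (suc n))) (Σ<-triangle n F) ⟩
  Σ< (suc n) rows + (Σ< (suc n) (λ j → F j (suc n)) + F (suc n) (suc n))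
    ≡⟨ +-assoc (Σ< (suc n) rows) _ _ ⟨
  (Σ< (suc n) rows + Σ< (suc n) (λ j → F j (suc n))) + F (suc n) (suc n)
    ≡⟨ cong₂ _+_ (sym (Σ<-+ (suc n) rows (λ j → F j (suc n)))) lastRow ⟩
  Σ< (suc n) (λ j → rows j + F j (suc n)) + Σ< (suc (suc n ∸ suc n)) (λ i → F (suc n) (suc n ℕ.+ i))
    ≡⟨ cong (_+ Σ< (suc (suc n ∸ suc n)) (λ i → F (suc n) (suc n ℕ.+ i))) (Σ<-cong (suc n) extendRow) ⟩
  Σ< (suc (suc n)) (λ j → Σ< (suc (suc n ∸ j)) (λ i → F j (j ℕ.+ i))) ∎
  where
  open ≡-Reasoning
  rows : ℕ → ℚ
  rows j = Σ< (suc (n ∸ j)) (λ i → F j (j ℕ.+ i))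
  lastRow : F (suc n) (suc n) ≡ Σ< (suc (n ∸ n)) (λ i → F (suc n) (suc n ℕ.+ i))
  lastRow rewrite ℕₚ.n∸n≡0 n | ℕₚ.+-identityʳ n = sym (+-identityˡ (F (suc n) (suc n)))
  extendRow : ∀ j → j ℕ.< suc n → rows j + F j (suc n) ≡ Σ< (suc (suc n ∸ j)) (λ i → F j (j ℕ.+ i))
  extendRow j (ℕ.s≤s j≤n) rewrite ℕₚ.+-∸-assoc 1 j≤n =
    cong (λ m → rows j + F j m) (sym (trans (ℕₚ.+-suc j (n ∸ j)) (cong suc (ℕₚ.m+[n∸m]≡n j≤n))))

-- The ring of formal power series

⊛-cong : ∀ {f f′ g g′} → f ≗ f′ → g ≗ g′ → (f ⊛ g) ≗ (f′ ⊛ g′)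
⊛-cong ff gg n = Σ<-cong (suc n) (λ k _ → cong₂ _*_ (ff k) (gg (n ∸ k)))

⊛-congˡ : ∀ {f f′} g → f ≗ f′ → (f ⊛ g) ≗ (f′ ⊛ g)
⊛-congˡ {f} {f′} g ff = ⊛-cong {f} {f′} {g} {g} ff (λ _ → refl)

⊛-congʳ : ∀ f {g g′} → g ≗ g′ → (f ⊛ g) ≗ (f ⊛ g′)
⊛-congʳ f {g} {g′} gg = ⊛-cong {f} {f} {g} {g′} (λ _ → refl) gg

⊛-comm : ∀ f g → (f ⊛ g) ≗ (g ⊛ f)
⊛-comm f g n = trans (Σ<-reverse (suc n) (λ k → f k * g (n ∸ k))) (Σ<-cong (suc n) swap)
  where
  swap : ∀ k → k ℕ.< suc n → f (n ∸ k) * g (n ∸ (n ∸ k)) ≡ g k * f (n ∸ k)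
  swap k (ℕ.s≤s k≤n) = trans (cong (λ m → f (n ∸ k) * g m) (ℕₚ.m∸[m∸n]≡n k≤n)) (*-comm (f (n ∸ k)) (g k))

⊛-assoc : ∀ f g h → ((f ⊛ g) ⊛ h) ≗ (f ⊛ (g ⊛ h))
⊛-assoc f g h n = begin
  Σ< (suc n) (λ k → Σ< (suc k) (λ j → f j * g (k ∸ j)) * h (n ∸ k))
    ≡⟨ Σ<-cong (suc n) (λ k _ → Σ<-*ʳ (suc k) (h (n ∸ k)) (λ j → f j * g (k ∸ j))) ⟩
  Σ< (suc n) (λ k → Σ< (suc k) (λ j → f j * g (k ∸ j) * h (n ∸ k)))
    ≡⟨ Σ<-triangle n (λ j k → f j * g (k ∸ j) * h (n ∸ k)) ⟩
  Σ< (suc n) (λ j → Σ< (suc (n ∸ j)) (λ i → f j * g (j ℕ.+ i ∸ j) * h (n ∸ (j ℕ.+ i))))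
    ≡⟨ Σ<-cong (suc n) (λ j _ → Σ<-cong (suc (n ∸ j)) (λ i _ → reindex j i)) ⟩
  Σ< (suc n) (λ j → Σ< (suc (n ∸ j)) (λ i → f j * (g i * h (n ∸ j ∸ i))))
    ≡⟨ Σ<-cong (suc n) (λ j _ → Σ<-*ˡ (suc (n ∸ j)) (f j) (λ i → g i * h (n ∸ j ∸ i))) ⟨
  Σ< (suc n) (λ j → f j * Σ< (suc (n ∸ j)) (λ i → g i * h (n ∸ j ∸ i))) ∎
  where
  open ≡-Reasoning
  reindex : ∀ j i → f j * g (j ℕ.+ i ∸ j) * h (n ∸ (j ℕ.+ i)) ≡ f j * (g i * h (n ∸ j ∸ i))
  reindex j i = trans (cong₂ (λ a b → f j * g a * h b) (ℕₚ.m+n∸m≡n j i) (sym (ℕₚ.∸-+-assoc n j i)))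
                      (*-assoc (f j) (g i) (h (n ∸ j ∸ i)))

⊛-identityʳ : ∀ f → (f ⊛ oneS) ≗ f
⊛-identityʳ f n = begin
  Σ< n (λ k → f k * oneS (n ∸ k)) + f n * oneS (n ∸ n)  ≡⟨ cong₂ _+_ (trans (Σ<-cong n vanish) (Σ<-0 n))
                                                                     (cong (λ m → f n * oneS m) (ℕₚ.n∸n≡0 n)) ⟩
  0ℚ + f n * 1ℚ                                         ≡⟨ trans (+-identityˡ _) (*-identityʳ (f n)) ⟩
  f n                                                   ∎
  where
  open ≡-Reasoning
  vanish : ∀ k → k ℕ.< n → f k * oneS (n ∸ k) ≡ 0ℚ
  vanish k k<n rewrite ℕₚ.+-∸-assoc 1 k<n = *-zeroʳ (f k)

⊛-distribˡ-⊕ : ∀ f g h → (f ⊛ (g ⊕ h)) ≗ ((f ⊛ g) ⊕ (f ⊛ h))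
⊛-distribˡ-⊕ f g h n =
  trans (Σ<-cong (suc n) (λ k _ → *-distribˡ-+ (f k) (g (n ∸ k)) (h (n ∸ k)))) (Σ<-+ (suc n) _ _)

⊛-negʳ : ∀ f g → (f ⊛ (λ m → - g m)) ≗ (λ m → - (f ⊛ g) m)
⊛-negʳ f g n = trans (Σ<-cong (suc n) (λ k _ → sym (neg-distribʳ-* (f k) (g (n ∸ k))))) (Σ<-neg (suc n) _)

⊛-distribˡ-⊖ : ∀ f g h → (f ⊛ (g ⊖ h)) ≗ ((f ⊛ g) ⊖ (f ⊛ h))
⊛-distribˡ-⊖ f g h n =
  trans (⊛-distribˡ-⊕ f g (λ m → - h m) n) (cong (λ z → (f ⊛ g) n + z) (⊛-negʳ f h n))

X-⊛-zero : ∀ h → (X ⊛ h) 0 ≡ 0ℚ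
X-⊛-zero h = trans (+-identityˡ (0ℚ * h 0)) (*-zeroˡ (h 0))

X-⊛-suc : ∀ h n → (X ⊛ h) (suc n) ≡ h n
X-⊛-suc h n = begin
  (X ⊛ h) (suc n)
    ≡⟨ Σ<-head (suc n) (λ k → X k * h (suc n ∸ k)) ⟩
  0ℚ * h (suc n) + Σ< (suc n) (λ k → X (suc k) * h (n ∸ k))
    ≡⟨ cong (λ z → 0ℚ * h (suc n) + z) (Σ<-head n (λ k → X (suc k) * h (n ∸ k))) ⟩
  0ℚ * h (suc n) + (1ℚ * h n + Σ< n (λ k → 0ℚ * h (n ∸ suc k)))
    ≡⟨ cong (λ z → 0ℚ * h (suc n) + (1ℚ * h n + z)) (trans (Σ<-cong n (λ k _ → *-zeroˡ (h (n ∸ suc k)))) (Σ<-0 n)) ⟩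
  0ℚ * h (suc n) + (1ℚ * h n + 0ℚ)
    ≡⟨ solve 2 (λ a b → con 0ℚ :* a :+ (con 1ℚ :* b :+ con 0ℚ) := b) refl (h (suc n)) (h n) ⟩
  h n ∎
  where open ≡-Reasoning

if-≤ᵇ : ∀ {A : Set} {k n} {x y : A} → k ℕ.≤ n → (if k ≤ᵇ n then x else y) ≡ x
if-≤ᵇ {k = k} {n} k≤n with k ≤ᵇ n | ℕₚ.≤⇒≤ᵇ k≤n
... | true | _ = refl

if-≰ᵇ : ∀ {A : Set} {k n} {x y : A} → n ℕ.< k → (if k ≤ᵇ n then x else y) ≡ y
if-≰ᵇ {k = k} {n} n<k with k ≤ᵇ n | ℕₚ.≤ᵇ⇒≤ k n
... | true  | k≤n = ⊥-elim (ℕₚ.<⇒≱ n<k (k≤n _))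
... | false | _   = refl

module MemoTable {A : Set} (T : ℕ → ℕ → A) (next : ℕ → A)
                 (T-suc : ∀ n k → T (suc n) k ≡ (if k ≤ᵇ n then T n k else next n)) where

  diagonal : ∀ n → T (suc n) (suc n) ≡ next n
  diagonal n = trans (T-suc n (suc n)) (if-≰ᵇ (ℕₚ.n<1+n n))

  stable : ∀ {n k} → k ℕ.≤ n → T n k ≡ T k k
  stable {zero}  ℕ.z≤n = refl
  stable {suc n} k≤1+n with ℕₚ.m≤n⇒m<n∨m≡n k≤1+n
  ... | inj₁ (ℕ.s≤s k≤n) = trans (trans (T-suc n _) (if-≤ᵇ k≤n)) (stable k≤n)
  ... | inj₂ refl        = refl

invS-suc : ∀ f .{{_ : NonZero (f 0)}} n →
           invS f (suc n) ≡ - (1/ (f 0) * Σ< (suc n) (λ j → invS f j * f (suc n ∸ j)))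
invS-suc f n = trans (diagonal n)
  (cong (λ z → - (1/ (f 0) * z)) (Σ<-cong (suc n) (λ { j (ℕ.s≤s j≤n) → cong (_* f (suc n ∸ j)) (stable j≤n) })))
  where
  open MemoTable (invTable f) (λ n → - (1/ (f 0) * Σ< (suc n) (λ j → invTable f n j * f (suc n ∸ j))))
                 (λ _ _ → refl)

invS-inverseˡ : ∀ f .{{_ : NonZero (f 0)}} → (invS f ⊛ f) ≗ oneS
invS-inverseˡ f zero    = trans (+-identityˡ _) (*-inverseˡ (f 0))
invS-inverseˡ f (suc n) = begin
  S + invS f (suc n) * f (suc n ∸ suc n)   ≡⟨ cong₂ (λ a b → S + a * f b) (invS-suc f n) (ℕₚ.n∸n≡0 n) ⟩
  S + - (1/ (f 0) * S) * f 0               ≡⟨ solve 3 (λ c e s → s :+ (:- (c :* s)) :* e := s :- s :* (c :* e)) refl (1/ (f 0)) (f 0) S ⟩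
  S - S * (1/ (f 0) * f 0)                 ≡⟨ cong (λ z → S - S * z) (*-inverseˡ (f 0)) ⟩
  S - S * 1ℚ                               ≡⟨ solve 1 (λ s → s :- s :* con 1ℚ := con 0ℚ) refl S ⟩
  0ℚ                                       ∎
  where
  open ≡-Reasoning
  S : ℚ
  S = Σ< (suc n) (λ j → invS f j * f (suc n ∸ j))

⊛-invS-⊛ : ∀ a e .{{_ : NonZero (e 0)}} → ((a ⊛ invS e) ⊛ e) ≗ a
⊛-invS-⊛ a e n = trans (⊛-assoc a (invS e) e n) (trans (⊛-congʳ a (invS-inverseˡ e) n) (⊛-identityʳ a n))

⊛-⊛-invS : ∀ a e .{{_ : NonZero (e 0)}} → ((a ⊛ e) ⊛ invS e) ≗ a
⊛-⊛-invS a e n = begin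
  ((a ⊛ e) ⊛ invS e) n   ≡⟨ ⊛-assoc a e (invS e) n ⟩
  (a ⊛ (e ⊛ invS e)) n   ≡⟨ ⊛-congʳ a (⊛-comm e (invS e)) n ⟩
  (a ⊛ (invS e ⊛ e)) n   ≡⟨ ⊛-assoc a (invS e) e n ⟨
  ((a ⊛ invS e) ⊛ e) n   ≡⟨ ⊛-invS-⊛ a e n ⟩
  a n                    ∎
  where open ≡-Reasoning

-- Formal differentiation

D-⊛ : ∀ f g → D (f ⊛ g) ≗ ((D f ⊛ g) ⊕ (f ⊛ D g))
D-⊛ f g n = begin
  ℕ→ℚ (suc n) * Σ< (suc (suc n)) F
    ≡⟨ Σ<-*ˡ (suc (suc n)) (ℕ→ℚ (suc n)) F ⟩
  Σ< (suc (suc n)) (λ k → ℕ→ℚ (suc n) * F k)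
    ≡⟨ Σ<-cong (suc (suc n)) split ⟩
  Σ< (suc (suc n)) (λ k → ℕ→ℚ k * F k + ℕ→ℚ (suc n ∸ k) * F k)
    ≡⟨ Σ<-+ (suc (suc n)) (λ k → ℕ→ℚ k * F k) (λ k → ℕ→ℚ (suc n ∸ k) * F k) ⟩
  Σ< (suc (suc n)) (λ k → ℕ→ℚ k * F k) + Σ< (suc (suc n)) (λ k → ℕ→ℚ (suc n ∸ k) * F k)
    ≡⟨ cong₂ _+_ differentiateLeft differentiateRight ⟩
  (D f ⊛ g) n + (f ⊛ D g) n ∎
  where
  open ≡-Reasoning
  F : ℕ → ℚ
  F k = f k * g (suc n ∸ k)
  split : ∀ k → k ℕ.< suc (suc n) → ℕ→ℚ (suc n) * F k ≡ ℕ→ℚ k * F k + ℕ→ℚ (suc n ∸ k) * F k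
  split k (ℕ.s≤s k≤1+n) = trans (cong (λ m → ℕ→ℚ m * F k) (sym (ℕₚ.m+[n∸m]≡n k≤1+n)))
                                (trans (cong (_* F k) (ℕ→ℚ-+ k (suc n ∸ k))) (*-distribʳ-+ (F k) (ℕ→ℚ k) (ℕ→ℚ (suc n ∸ k))))
  differentiateLeft : Σ< (suc (suc n)) (λ k → ℕ→ℚ k * F k) ≡ (D f ⊛ g) n
  differentiateLeft = begin
    Σ< (suc (suc n)) (λ k → ℕ→ℚ k * F k)
      ≡⟨ Σ<-head (suc n) (λ k → ℕ→ℚ k * F k) ⟩
    0ℚ * F 0 + Σ< (suc n) (λ k → ℕ→ℚ (suc k) * F (suc k))
      ≡⟨ trans (cong (_+ Σ< (suc n) (λ k → ℕ→ℚ (suc k) * F (suc k))) (*-zeroˡ (F 0))) (+-identityˡ _) ⟩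
    Σ< (suc n) (λ k → ℕ→ℚ (suc k) * F (suc k))
      ≡⟨ Σ<-cong (suc n) (λ k _ → sym (*-assoc (ℕ→ℚ (suc k)) (f (suc k)) (g (n ∸ k)))) ⟩
    (D f ⊛ g) n ∎
  differentiateRight : Σ< (suc (suc n)) (λ k → ℕ→ℚ (suc n ∸ k) * F k) ≡ (f ⊛ D g) n
  differentiateRight = begin
    Σ< (suc n) (λ k → ℕ→ℚ (suc n ∸ k) * F k) + ℕ→ℚ (suc n ∸ suc n) * F (suc n)
      ≡⟨ cong₂ _+_ (Σ<-cong (suc n) inner) (trans (cong (λ m → ℕ→ℚ m * F (suc n)) (ℕₚ.n∸n≡0 n)) (*-zeroˡ (F (suc n)))) ⟩
    (f ⊛ D g) n + 0ℚ
      ≡⟨ +-identityʳ _ ⟩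
    (f ⊛ D g) n ∎
    where
    inner : ∀ k → k ℕ.< suc n → ℕ→ℚ (suc n ∸ k) * F k ≡ f k * D g (n ∸ k)
    inner k (ℕ.s≤s k≤n) rewrite ℕₚ.+-∸-assoc 1 k≤n =
      solve 3 (λ a b c → a :* (b :* c) := b :* (a :* c)) refl (ℕ→ℚ (suc (n ∸ k))) (f k) (g (suc (n ∸ k)))

D≗0⇒constant : ∀ f → (∀ n → D f n ≡ 0ℚ) → ∀ n → f (suc n) ≡ 0ℚ
D≗0⇒constant f D≗0 n = ℕ→ℚ-*-cancelˡ (suc n) (trans (D≗0 n) (sym (*-zeroʳ (ℕ→ℚ (suc n)))))

n!*expS≡1 : ∀ n → ℕ→ℚ (n !) * expS n ≡ 1ℚ
n!*expS≡1 n = ℕ→ℚ-*-inverseʳ (n !) {{n !≢0}}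

D-expS : D expS ≗ expS
D-expS n = ℕ→ℚ-*-cancelˡ (n !) {{n !≢0}} (begin
  ℕ→ℚ (n !) * (ℕ→ℚ (suc n) * expS (suc n))   ≡⟨ solve 3 (λ a b e → a :* (b :* e) := (b :* a) :* e) refl
                                                    (ℕ→ℚ (n !)) (ℕ→ℚ (suc n)) (expS (suc n)) ⟩
  (ℕ→ℚ (suc n) * ℕ→ℚ (n !)) * expS (suc n)   ≡⟨ cong (_* expS (suc n)) (ℕ→ℚ-* (suc n) (n !)) ⟨
  ℕ→ℚ (suc n !) * expS (suc n)               ≡⟨ n!*expS≡1 (suc n) ⟩
  1ℚ                                         ≡⟨ n!*expS≡1 n ⟨
  ℕ→ℚ (n !) * expS n                         ∎)
  where open ≡-Reasoning

-- The reflection f(x) ↦ f(-x)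

sign : ℕ → ℚ
sign zero    = 1ℚ
sign (suc n) = - sign n

sign-+ : ∀ a b → sign (a ℕ.+ b) ≡ sign a * sign b
sign-+ zero    b = sym (*-identityˡ (sign b))
sign-+ (suc a) b = trans (cong -_ (sign-+ a b)) (neg-distribˡ-* (sign a) (sign b))

sign-odd : ∀ k → sign (suc (k ℕ.+ k)) ≡ - 1ℚ
sign-odd k = cong -_ (trans (sign-+ k k) (square k))
  where
  square : ∀ a → sign a * sign a ≡ 1ℚ
  square zero    = refl
  square (suc a) = trans (solve 1 (λ x → (:- x) :* (:- x) := x :* x) refl (sign a)) (square a)

reflect : FPS → FPS
reflect f n = sign n * f n

reflect-cong : ∀ {f g} → f ≗ g → reflect f ≗ reflect g
reflect-cong eq n = cong (sign n *_) (eq n)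

reflect-⊛ : ∀ f g → reflect (f ⊛ g) ≗ (reflect f ⊛ reflect g)
reflect-⊛ f g n = trans (Σ<-*ˡ (suc n) (sign n) _) (Σ<-cong (suc n) term)
  where
  term : ∀ k → k ℕ.< suc n → sign n * (f k * g (n ∸ k)) ≡ reflect f k * reflect g (n ∸ k)
  term k (ℕ.s≤s k≤n) = trans
    (cong (_* (f k * g (n ∸ k))) (trans (cong sign (sym (ℕₚ.m+[n∸m]≡n k≤n))) (sign-+ k (n ∸ k))))
    (solve 4 (λ a b c d → (a :* b) :* (c :* d) := (a :* c) :* (b :* d)) refl (sign k) (sign (n ∸ k)) (f k) (g (n ∸ k)))

reflect-⊕-oneS : ∀ f → reflect (f ⊕ oneS) ≗ (reflect f ⊕ oneS)
reflect-⊕-oneS f zero    = *-distribˡ-+ 1ℚ (f 0) 1ℚ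
reflect-⊕-oneS f (suc n) =
  trans (*-distribˡ-+ (sign (suc n)) (f (suc n)) 0ℚ) (cong (reflect f (suc n) +_) (*-zeroʳ (sign (suc n))))

D-reflect : ∀ f → D (reflect f) ≗ (λ n → - reflect (D f) n)
D-reflect f n =
  solve 3 (λ a s x → a :* ((:- s) :* x) := :- (s :* (a :* x))) refl (ℕ→ℚ (suc n)) (sign n) (f (suc n))

expS-⊛-reflect-expS : (expS ⊛ reflect expS) ≗ oneS
expS-⊛-reflect-expS zero    = refl
expS-⊛-reflect-expS (suc n) = D≗0⇒constant (expS ⊛ reflect expS) derivative≡0 n
  where
  derivative≡0 : ∀ n → D (expS ⊛ reflect expS) n ≡ 0ℚ
  derivative≡0 n = begin
    D (expS ⊛ reflect expS) n
      ≡⟨ D-⊛ expS (reflect expS) n ⟩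
    (D expS ⊛ reflect expS) n + (expS ⊛ D (reflect expS)) n
      ≡⟨ cong₂ _+_ (⊛-congˡ (reflect expS) D-expS n) (⊛-congʳ expS (D-reflect expS) n) ⟩
    (expS ⊛ reflect expS) n + (expS ⊛ (λ m → - reflect (D expS) m)) n
      ≡⟨ cong (λ z → (expS ⊛ reflect expS) n + z)
              (trans (⊛-negʳ expS (reflect (D expS)) n) (cong -_ (⊛-congʳ expS (reflect-cong D-expS) n))) ⟩
    (expS ⊛ reflect expS) n - (expS ⊛ reflect expS) n
      ≡⟨ +-inverseʳ ((expS ⊛ reflect expS) n) ⟩
    0ℚ ∎
    where open ≡-Reasoning

-- Evenness of G̃

ExpSymmetric : FPS → Set
ExpSymmetric u = (expS ⊛ reflect u) ≗ u

quotient-even : ∀ a e .{{_ : NonZero (e 0)}} → ExpSymmetric a → ExpSymmetric e →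
                reflect (a ⊛ invS e) ≗ (a ⊛ invS e)
quotient-even a e a-sym e-sym n = begin
  reflect f n                          ≡⟨ ⊛-⊛-invS (reflect f) e n ⟨
  ((reflect f ⊛ e) ⊛ invS e) n         ≡⟨ ⊛-congˡ (invS e) reflect-f⊛e n ⟩
  ((f ⊛ e) ⊛ invS e) n                 ≡⟨ ⊛-⊛-invS f e n ⟩
  f n                                  ∎
  where
  open ≡-Reasoning
  f : FPS
  f = a ⊛ invS e
  reflect-f⊛e : (reflect f ⊛ e) ≗ (f ⊛ e)
  reflect-f⊛e m = begin
    (reflect f ⊛ e) m                         ≡⟨ ⊛-congʳ (reflect f) e-sym m ⟨
    (reflect f ⊛ (expS ⊛ reflect e)) m        ≡⟨ ⊛-assoc (reflect f) expS (reflect e) m ⟨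
    ((reflect f ⊛ expS) ⊛ reflect e) m        ≡⟨ ⊛-congˡ (reflect e) (⊛-comm (reflect f) expS) m ⟩
    ((expS ⊛ reflect f) ⊛ reflect e) m        ≡⟨ ⊛-assoc expS (reflect f) (reflect e) m ⟩
    (expS ⊛ (reflect f ⊛ reflect e)) m        ≡⟨ ⊛-congʳ expS (reflect-⊛ f e) m ⟨
    (expS ⊛ reflect (f ⊛ e)) m                ≡⟨ ⊛-congʳ expS (reflect-cong (⊛-invS-⊛ a e)) m ⟩
    (expS ⊛ reflect a) m                      ≡⟨ a-sym m ⟩
    a m                                       ≡⟨ ⊛-invS-⊛ a e m ⟨
    (f ⊛ e) m                                 ∎

expPlus1-expSymmetric : ExpSymmetric expPlus1
expPlus1-expSymmetric n = begin
  (expS ⊛ reflect (expS ⊕ oneS)) n                   ≡⟨ ⊛-congʳ expS (reflect-⊕-oneS expS) n ⟩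
  (expS ⊛ (reflect expS ⊕ oneS)) n                   ≡⟨ ⊛-distribˡ-⊕ expS (reflect expS) oneS n ⟩
  (expS ⊛ reflect expS) n + (expS ⊛ oneS) n          ≡⟨ cong₂ _+_ (expS-⊛-reflect-expS n) (⊛-identityʳ expS n) ⟩
  oneS n + expS n                                    ≡⟨ +-comm (oneS n) (expS n) ⟩
  expPlus1 n                                         ∎
  where open ≡-Reasoning

x[eˣ-1] : FPS
x[eˣ-1] = X ⊛ (expS ⊖ oneS)

reflect-x[eˣ-1] : reflect x[eˣ-1] ≗ (X ⊛ (oneS ⊖ reflect expS))
reflect-x[eˣ-1] zero    = trans (cong (1ℚ *_) (X-⊛-zero (expS ⊖ oneS))) (sym (X-⊛-zero (oneS ⊖ reflect expS)))
reflect-x[eˣ-1] (suc n) = begin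
  - sign n * x[eˣ-1] (suc n)          ≡⟨ cong (- sign n *_) (X-⊛-suc (expS ⊖ oneS) n) ⟩
  - sign n * (expS n - oneS n)        ≡⟨ solve 3 (λ s a o → (:- s) :* (a :- o) := s :* o :- s :* a) refl
                                           (sign n) (expS n) (oneS n) ⟩
  sign n * oneS n - sign n * expS n   ≡⟨ cong (_- reflect expS n) (sign*oneS n) ⟩
  oneS n - reflect expS n             ≡⟨ X-⊛-suc (oneS ⊖ reflect expS) n ⟨
  (X ⊛ (oneS ⊖ reflect expS)) (suc n) ∎
  where
  open ≡-Reasoning
  sign*oneS : ∀ n → sign n * oneS n ≡ oneS n
  sign*oneS zero    = refl
  sign*oneS (suc n) = *-zeroʳ (- sign n)

x[eˣ-1]-expSymmetric : ExpSymmetric x[eˣ-1]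
x[eˣ-1]-expSymmetric n = begin
  (expS ⊛ reflect x[eˣ-1]) n                 ≡⟨ ⊛-congʳ expS reflect-x[eˣ-1] n ⟩
  (expS ⊛ (X ⊛ (oneS ⊖ reflect expS))) n     ≡⟨ ⊛-assoc expS X (oneS ⊖ reflect expS) n ⟨
  ((expS ⊛ X) ⊛ (oneS ⊖ reflect expS)) n     ≡⟨ ⊛-congˡ (oneS ⊖ reflect expS) (⊛-comm expS X) n ⟩
  ((X ⊛ expS) ⊛ (oneS ⊖ reflect expS)) n     ≡⟨ ⊛-assoc X expS (oneS ⊖ reflect expS) n ⟩
  (X ⊛ (expS ⊛ (oneS ⊖ reflect expS))) n     ≡⟨ ⊛-congʳ X expS⊛[1-e⁻ˣ] n ⟩
  x[eˣ-1] n                                  ∎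
  where
  open ≡-Reasoning
  expS⊛[1-e⁻ˣ] : (expS ⊛ (oneS ⊖ reflect expS)) ≗ (expS ⊖ oneS)
  expS⊛[1-e⁻ˣ] m = trans (⊛-distribˡ-⊖ expS oneS (reflect expS) m)
                         (cong₂ _-_ (⊛-identityʳ expS m) (expS-⊛-reflect-expS m))

Gt-even : reflect Gt ≗ Gt
Gt-even = quotient-even x[eˣ-1] expPlus1 x[eˣ-1]-expSymmetric expPlus1-expSymmetric

even⇒odd-coefficients≡0 : ∀ f → reflect f ≗ f → ∀ k → f (suc (k ℕ.+ k)) ≡ 0ℚ
even⇒odd-coefficients≡0 f even k =
  -1*x≡x⇒x≡0 (trans (cong (_* f (suc (k ℕ.+ k))) (sym (sign-odd k))) (even (suc (k ℕ.+ k))))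

-- Derivatives at 0 and the binomial transform

derivAt0≡n!*coefficient : ∀ n f → derivAt0 n f ≡ ℕ→ℚ (n !) * f n
derivAt0≡n!*coefficient n f = trans (sym (*-identityʳ (derivAt0 n f)))
  (trans (iterD-coefficient n 0) (cong (λ m → ℕ→ℚ (m !) * f m) (ℕₚ.+-identityʳ n)))
  where
  iterD-coefficient : ∀ m k → iterD m f k * ℕ→ℚ (k !) ≡ ℕ→ℚ ((m ℕ.+ k) !) * f (m ℕ.+ k)
  iterD-coefficient zero    k = *-comm (f k) (ℕ→ℚ (k !))
  iterD-coefficient (suc m) k = begin
    (ℕ→ℚ (suc k) * iterD m f (suc k)) * ℕ→ℚ (k !)
      ≡⟨ solve 3 (λ a y b → (a :* y) :* b := y :* (a :* b)) refl (ℕ→ℚ (suc k)) (iterD m f (suc k)) (ℕ→ℚ (k !)) ⟩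
    iterD m f (suc k) * (ℕ→ℚ (suc k) * ℕ→ℚ (k !))
      ≡⟨ cong (iterD m f (suc k) *_) (ℕ→ℚ-* (suc k) (k !)) ⟨
    iterD m f (suc k) * ℕ→ℚ (suc k !)
      ≡⟨ iterD-coefficient m (suc k) ⟩
    ℕ→ℚ ((m ℕ.+ suc k) !) * f (m ℕ.+ suc k)
      ≡⟨ cong (λ z → ℕ→ℚ (z !) * f z) (ℕₚ.+-suc m k) ⟩
    ℕ→ℚ ((suc m ℕ.+ k) !) * f (suc m ℕ.+ k) ∎
    where open ≡-Reasoning

derivAt0-cong : ∀ n {f g} → f ≗ g → derivAt0 n f ≡ derivAt0 n g
derivAt0-cong n {f} {g} eq = trans (derivAt0≡n!*coefficient n f)
  (trans (cong (ℕ→ℚ (n !) *_) (eq n)) (sym (derivAt0≡n!*coefficient n g)))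

binomialTransform : (ℕ → ℚ) → ℕ → ℚ
binomialTransform u n = Σ< (suc n) (λ k → ℕ→ℚ (n C k) * u k)

binomialTransform-head : ∀ u n → binomialTransform u n ≡ u 0 + Σ< n (λ k → ℕ→ℚ (n C suc k) * u (suc k))
binomialTransform-head u n = trans (Σ<-head n (λ k → ℕ→ℚ (n C k) * u k))
  (cong (_+ Σ< n (λ k → ℕ→ℚ (n C suc k) * u (suc k))) (*-identityˡ (u 0)))

binomialTransform-suc : ∀ u n →
  binomialTransform u (suc n) ≡ binomialTransform (λ k → u (suc k)) n + binomialTransform u n
binomialTransform-suc u n = begin
  binomialTransform u (suc n)
    ≡⟨ binomialTransform-head u (suc n) ⟩
  u 0 + Σ< (suc n) (λ k → ℕ→ℚ (suc n C suc k) * u (suc k))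
    ≡⟨ cong (u 0 +_) (trans (Σ<-cong (suc n) (λ k _ → pascal k)) (Σ<-+ (suc n) _ _)) ⟩
  u 0 + (T + (S + ℕ→ℚ (n C suc n) * u (suc n)))
    ≡⟨ cong (λ z → u 0 + (T + (S + ℕ→ℚ z * u (suc n)))) (k>n⇒nCk≡0 (ℕₚ.n<1+n n)) ⟩
  u 0 + (T + (S + 0ℚ * u (suc n)))
    ≡⟨ solve 4 (λ a t s x → a :+ (t :+ (s :+ con 0ℚ :* x)) := t :+ (a :+ s)) refl (u 0) T S (u (suc n)) ⟩
  T + (u 0 + S)
    ≡⟨ cong (T +_) (binomialTransform-head u n) ⟨
  T + binomialTransform u n ∎
  where
  open ≡-Reasoning
  T S : ℚ
  T = binomialTransform (λ k → u (suc k)) n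
  S = Σ< n (λ k → ℕ→ℚ (n C suc k) * u (suc k))
  pascal : ∀ k → ℕ→ℚ (suc n C suc k) * u (suc k) ≡ ℕ→ℚ (n C k) * u (suc k) + ℕ→ℚ (n C suc k) * u (suc k)
  pascal k = trans (cong (λ z → ℕ→ℚ z * u (suc k)) (sym (nCk+nC[k+1]≡[n+1]C[k+1] n k)))
    (trans (cong (_* u (suc k)) (ℕ→ℚ-+ (n C k) (n C suc k))) (*-distribʳ-+ (u (suc k)) (ℕ→ℚ (n C k)) (ℕ→ℚ (n C suc k))))

n!*expS[n∸k]≡nCk*k! : ∀ n k → k ℕ.≤ n → ℕ→ℚ (n !) * expS (n ∸ k) ≡ ℕ→ℚ (n C k) * ℕ→ℚ (k !)
n!*expS[n∸k]≡nCk*k! n k k≤n = begin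
  ℕ→ℚ (n !) * expS (n ∸ k)
    ≡⟨ cong (λ z → ℕ→ℚ z * expS (n ∸ k)) nCk*k!*[n∸k]!≡n! ⟨
  ℕ→ℚ ((n C k) ℕ.* (k ! ℕ.* (n ∸ k) !)) * expS (n ∸ k)
    ≡⟨ cong (_* expS (n ∸ k)) (trans (ℕ→ℚ-* (n C k) _) (cong (ℕ→ℚ (n C k) *_) (ℕ→ℚ-* (k !) ((n ∸ k) !)))) ⟩
  ℕ→ℚ (n C k) * (ℕ→ℚ (k !) * ℕ→ℚ ((n ∸ k) !)) * expS (n ∸ k)
    ≡⟨ solve 4 (λ a b c e → a :* (b :* c) :* e := a :* b :* (c :* e)) refl
               (ℕ→ℚ (n C k)) (ℕ→ℚ (k !)) (ℕ→ℚ ((n ∸ k) !)) (expS (n ∸ k)) ⟩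
  ℕ→ℚ (n C k) * ℕ→ℚ (k !) * (ℕ→ℚ ((n ∸ k) !) * expS (n ∸ k))
    ≡⟨ cong (ℕ→ℚ (n C k) * ℕ→ℚ (k !) *_) (n!*expS≡1 (n ∸ k)) ⟩
  ℕ→ℚ (n C k) * ℕ→ℚ (k !) * 1ℚ
    ≡⟨ *-identityʳ _ ⟩
  ℕ→ℚ (n C k) * ℕ→ℚ (k !) ∎
  where
  open ≡-Reasoning
  nCk*k!*[n∸k]!≡n! : (n C k) ℕ.* (k ! ℕ.* (n ∸ k) !) ≡ n !
  nCk*k!*[n∸k]!≡n! = trans (cong (ℕ._* (k ! ℕ.* (n ∸ k) !)) (nCk≡n!/k![n-k]! k≤n))
                           (m/n*n≡m {{k !* (n ∸ k) !≢0}} (k![n∸k]!∣n! k≤n))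

derivAt0-⊛-expS : ∀ f n → derivAt0 n (f ⊛ expS) ≡ binomialTransform (λ k → derivAt0 k f) n
derivAt0-⊛-expS f n = begin
  derivAt0 n (f ⊛ expS)                                    ≡⟨ derivAt0≡n!*coefficient n (f ⊛ expS) ⟩
  ℕ→ℚ (n !) * (f ⊛ expS) n                                 ≡⟨ Σ<-*ˡ (suc n) (ℕ→ℚ (n !)) _ ⟩
  Σ< (suc n) (λ k → ℕ→ℚ (n !) * (f k * expS (n ∸ k)))      ≡⟨ Σ<-cong (suc n) (λ { k (ℕ.s≤s k≤n) → term k k≤n }) ⟩
  binomialTransform (λ k → derivAt0 k f) n                 ∎
  where
  open ≡-Reasoning
  term : ∀ k → k ℕ.≤ n → ℕ→ℚ (n !) * (f k * expS (n ∸ k)) ≡ ℕ→ℚ (n C k) * derivAt0 k f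
  term k k≤n = begin
    ℕ→ℚ (n !) * (f k * expS (n ∸ k))     ≡⟨ solve 3 (λ a b c → a :* (b :* c) := (a :* c) :* b) refl
                                              (ℕ→ℚ (n !)) (f k) (expS (n ∸ k)) ⟩
    ℕ→ℚ (n !) * expS (n ∸ k) * f k       ≡⟨ cong (_* f k) (n!*expS[n∸k]≡nCk*k! n k k≤n) ⟩
    ℕ→ℚ (n C k) * ℕ→ℚ (k !) * f k        ≡⟨ *-assoc (ℕ→ℚ (n C k)) (ℕ→ℚ (k !)) (f k) ⟩
    ℕ→ℚ (n C k) * (ℕ→ℚ (k !) * f k)      ≡⟨ cong (ℕ→ℚ (n C k) *_) (derivAt0≡n!*coefficient k f) ⟨
    ℕ→ℚ (n C k) * derivAt0 k f           ∎

derivAt0-⊛-expPlus1 : ∀ f n →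
  derivAt0 n (f ⊛ expPlus1) ≡ binomialTransform (λ k → derivAt0 k f) n + derivAt0 n f
derivAt0-⊛-expPlus1 f n = begin
  derivAt0 n (f ⊛ expPlus1)
    ≡⟨ derivAt0≡n!*coefficient n (f ⊛ expPlus1) ⟩
  ℕ→ℚ (n !) * (f ⊛ expPlus1) n
    ≡⟨ cong (ℕ→ℚ (n !) *_) (⊛-distribˡ-⊕ f expS oneS n) ⟩
  ℕ→ℚ (n !) * ((f ⊛ expS) n + (f ⊛ oneS) n)
    ≡⟨ *-distribˡ-+ (ℕ→ℚ (n !)) _ _ ⟩
  ℕ→ℚ (n !) * (f ⊛ expS) n + ℕ→ℚ (n !) * (f ⊛ oneS) n
    ≡⟨ cong₂ _+_ (sym (derivAt0≡n!*coefficient n (f ⊛ expS))) (cong (ℕ→ℚ (n !) *_) (⊛-identityʳ f n)) ⟩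
  derivAt0 n (f ⊛ expS) + ℕ→ℚ (n !) * f n
    ≡⟨ cong₂ _+_ (derivAt0-⊛-expS f n) (sym (derivAt0≡n!*coefficient n f)) ⟩
  binomialTransform (λ k → derivAt0 k f) n + derivAt0 n f ∎
  where open ≡-Reasoning

derivAt0-x[eˣ-1] : ∀ m → derivAt0 (2 ℕ.+ m) x[eˣ-1] ≡ ℕ→ℚ (2 ℕ.+ m)
derivAt0-x[eˣ-1] m = begin
  derivAt0 (2 ℕ.+ m) x[eˣ-1]
    ≡⟨ derivAt0≡n!*coefficient (2 ℕ.+ m) x[eˣ-1] ⟩
  ℕ→ℚ ((2 ℕ.+ m) !) * x[eˣ-1] (2 ℕ.+ m)
    ≡⟨ cong₂ _*_ (ℕ→ℚ-* (2 ℕ.+ m) (suc m !)) (X-⊛-suc (expS ⊖ oneS) (suc m)) ⟩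
  ℕ→ℚ (2 ℕ.+ m) * ℕ→ℚ (suc m !) * (expS (suc m) - 0ℚ)
    ≡⟨ solve 3 (λ a b e → a :* b :* (e :- con 0ℚ) := a :* (b :* e)) refl (ℕ→ℚ (2 ℕ.+ m)) (ℕ→ℚ (suc m !)) (expS (suc m)) ⟩
  ℕ→ℚ (2 ℕ.+ m) * (ℕ→ℚ (suc m !) * expS (suc m))
    ≡⟨ cong (ℕ→ℚ (2 ℕ.+ m) *_) (n!*expS≡1 (suc m)) ⟩
  ℕ→ℚ (2 ℕ.+ m) * 1ℚ
    ≡⟨ *-identityʳ _ ⟩
  ℕ→ℚ (2 ℕ.+ m) ∎
  where open ≡-Reasoning

-- The recurrence

Gt⁽_⁾ : ℕ → ℚ
Gt⁽ n ⁾ = derivAt0 n Gt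

Gt⁽odd⁾≡0 : ∀ k → Gt⁽ suc (k ℕ.+ k) ⁾ ≡ 0ℚ
Gt⁽odd⁾≡0 k = begin
  Gt⁽ suc (k ℕ.+ k) ⁾                          ≡⟨ derivAt0≡n!*coefficient (suc (k ℕ.+ k)) Gt ⟩
  ℕ→ℚ (suc (k ℕ.+ k) !) * Gt (suc (k ℕ.+ k))   ≡⟨ cong (ℕ→ℚ (suc (k ℕ.+ k) !) *_) (even⇒odd-coefficients≡0 Gt Gt-even k) ⟩
  ℕ→ℚ (suc (k ℕ.+ k) !) * 0ℚ                   ≡⟨ *-zeroʳ (ℕ→ℚ (suc (k ℕ.+ k) !)) ⟩
  0ℚ                                           ∎
  where open ≡-Reasoning

Gt⁽⁾-binomial : ∀ m → Gt⁽ 2 ℕ.+ m ⁾ ≡ ℕ→ℚ (2 ℕ.+ m) - binomialTransform Gt⁽_⁾ (2 ℕ.+ m)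
Gt⁽⁾-binomial m = +-move (begin
  binomialTransform Gt⁽_⁾ (2 ℕ.+ m) + Gt⁽ 2 ℕ.+ m ⁾   ≡⟨ derivAt0-⊛-expPlus1 Gt (2 ℕ.+ m) ⟨
  derivAt0 (2 ℕ.+ m) (Gt ⊛ expPlus1)                 ≡⟨ derivAt0-cong (2 ℕ.+ m) (⊛-invS-⊛ x[eˣ-1] expPlus1) ⟩
  derivAt0 (2 ℕ.+ m) x[eˣ-1]                         ≡⟨ derivAt0-x[eˣ-1] m ⟩
  ℕ→ℚ (2 ℕ.+ m)                                      ∎)
  where open ≡-Reasoning

shiftedBinomialSum : (ℕ → ℚ) → ℕ → ℚ
shiftedBinomialSum u n = Σ< n (λ k → u k * ℕ→ℚ (n C suc k))

shiftedBinomialSum-suc : ∀ u m → shiftedBinomialSum u (suc m) ≡ Σ< m (λ k → u k * ℕ→ℚ (suc m C suc k)) + u m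
shiftedBinomialSum-suc u m =
  cong (Σ< m (λ k → u k * ℕ→ℚ (suc m C suc k)) +_) (trans (cong (λ c → u m * ℕ→ℚ c) (nCn≡1 (suc m))) (*-identityʳ (u m)))

binomialTransform-suc-pairs : ∀ u n →
  binomialTransform u (suc n) ≡ (u 0 + u 1) + shiftedBinomialSum (λ k → u (suc k) + u (2 ℕ.+ k)) n
binomialTransform-suc-pairs u n = begin
  binomialTransform u (suc n)
    ≡⟨ binomialTransform-suc u n ⟩
  binomialTransform (λ k → u (suc k)) n + binomialTransform u n
    ≡⟨ cong₂ _+_ (binomialTransform-head (λ k → u (suc k)) n) (binomialTransform-head u n) ⟩
  (u 1 + S₂) + (u 0 + S₁)
    ≡⟨ solve 4 (λ a b x y → (b :+ y) :+ (a :+ x) := (a :+ b) :+ (x :+ y)) refl (u 0) (u 1) S₁ S₂ ⟩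
  (u 0 + u 1) + (S₁ + S₂)
    ≡⟨ cong ((u 0 + u 1) +_) pairUp ⟨
  (u 0 + u 1) + shiftedBinomialSum (λ k → u (suc k) + u (2 ℕ.+ k)) n ∎
  where
  open ≡-Reasoning
  S₁ S₂ : ℚ
  S₁ = Σ< n (λ k → ℕ→ℚ (n C suc k) * u (suc k))
  S₂ = Σ< n (λ k → ℕ→ℚ (n C suc k) * u (2 ℕ.+ k))
  pairUp : shiftedBinomialSum (λ k → u (suc k) + u (2 ℕ.+ k)) n ≡ S₁ + S₂
  pairUp = trans (Σ<-cong n (λ k _ → trans (*-comm (u (suc k) + u (2 ℕ.+ k)) (ℕ→ℚ (n C suc k)))
                                            (*-distribˡ-+ (ℕ→ℚ (n C suc k)) (u (suc k)) (u (2 ℕ.+ k)))))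
                 (Σ<-+ n _ _)

-- For even n the second term vanishes, for odd n the first; keeping both makes β obey the
-- recurrence of b_G for every n.
β : ℕ → ℚ
β n = Gt⁽ 2 ℕ.+ n ⁾ + Gt⁽ 3 ℕ.+ n ⁾

-- The constant 1ℚ is G̃⁽¹⁾(0) + G̃⁽²⁾(0) = 0 + 1, found by evaluation.
shiftedBinomialSum-β : ∀ n → shiftedBinomialSum β n ≡ binomialTransform (λ k → Gt⁽ suc k ⁾) (suc n) - 1ℚ
shiftedBinomialSum-β n = +-move {x = 1ℚ} (sym (binomialTransform-suc-pairs (λ k → Gt⁽ suc k ⁾) n))

β-difference : ∀ m → β (suc m) - β m ≡ - (shiftedBinomialSum β (suc m) + shiftedBinomialSum β (2 ℕ.+ m))
β-difference m = difference {a = ℕ→ℚ (2 ℕ.+ m)} {t₀ = T₀} {t₁ = T₁} {t₁′ = T₁′} {g₃ = Gt⁽ 3 ℕ.+ m ⁾}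
  (Gt⁽⁾-binomial m) Gt⁽4+m⁾ (shiftedBinomialSum-β (suc m)) (shiftedBinomialSum-β (2 ℕ.+ m))
  where
  T₀ T₁ T₁′ : ℚ
  T₀  = binomialTransform Gt⁽_⁾ (2 ℕ.+ m)
  T₁  = binomialTransform (λ k → Gt⁽ suc k ⁾) (2 ℕ.+ m)
  T₁′ = binomialTransform (λ k → Gt⁽ suc k ⁾) (3 ℕ.+ m)
  Gt⁽4+m⁾ : Gt⁽ 4 ℕ.+ m ⁾ ≡ (ℕ→ℚ 2 + ℕ→ℚ (2 ℕ.+ m)) - (T₁′ + (T₁ + T₀))
  Gt⁽4+m⁾ = trans (Gt⁽⁾-binomial (2 ℕ.+ m)) (cong₂ _-_ (ℕ→ℚ-+ 2 (2 ℕ.+ m))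
    (trans (binomialTransform-suc Gt⁽_⁾ (3 ℕ.+ m)) (cong (T₁′ +_) (binomialTransform-suc Gt⁽_⁾ (2 ℕ.+ m)))))
  difference : ∀ {a t₀ t₁ t₁′ g₂ g₃ g₄ s₁ s₂ : ℚ} →
    g₂ ≡ a - t₀ → g₄ ≡ (ℕ→ℚ 2 + a) - (t₁′ + (t₁ + t₀)) → s₁ ≡ t₁ - 1ℚ → s₂ ≡ t₁′ - 1ℚ →
    (g₃ + g₄) - (g₂ + g₃) ≡ - (s₁ + s₂)
  difference {a} {t₀} {t₁} {t₁′} {g₃ = g₃} refl refl refl refl =
    solve 5 (λ a t₀ t₁ t₁′ g₃ → (g₃ :+ ((con (ℕ→ℚ 2) :+ a) :- (t₁′ :+ (t₁ :+ t₀)))) :- ((a :- t₀) :+ g₃)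
                                := :- ((t₁ :- con 1ℚ) :+ (t₁′ :- con 1ℚ))) refl a t₀ t₁ t₁′ g₃

bStep-cong : ∀ n {u v : ℕ → ℚ} → (∀ k → k ℕ.< n → u k ≡ v k) → bStep n u ≡ bStep n v
bStep-cong 0 _ = refl
bStep-cong 1 _ = refl
bStep-cong 2 _ = refl
bStep-cong n@(suc (suc (suc p))) eq = cong (λ z → - (½ * z)) (cong₂ _+_
  (Σ<-cong (2 ℕ.+ p) (λ k k< → cong (_* ℕ→ℚ (n C suc k)) (eq k (ℕₚ.m<n⇒m<1+n k<))))
  (Σ<-cong n (λ k k< → cong (_* ℕ→ℚ (suc n C suc k)) (eq k k<))))

bStep-fixpoint-unique : ∀ {u v : ℕ → ℚ} → (∀ n → u n ≡ bStep n u) → (∀ n → v n ≡ bStep n v) → ∀ n → u n ≡ v n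
bStep-fixpoint-unique {u} {v} u-fix v-fix = <-rec (λ n → u n ≡ v n)
  (λ n ih → trans (u-fix n) (trans (bStep-cong n (λ k k<n → ih k<n)) (sym (v-fix n))))

bG-fixpoint : ∀ n → bG n ≡ bStep n bG
bG-fixpoint zero    = refl
bG-fixpoint (suc n) = trans (diagonal n) (bStep-cong (suc n) (λ { k (ℕ.s≤s k≤n) → stable k≤n }))
  where open MemoTable bTable (λ n → bStep (suc n) (bTable n)) (λ _ _ → refl)

β-fixpoint : ∀ n → β n ≡ bStep n β
β-fixpoint 0 = refl
β-fixpoint 1 = refl
β-fixpoint 2 = refl
β-fixpoint n@(suc (suc (suc p))) = halve {X₁ = S₁} {X₂ = S₂} (trans (β-difference (2 ℕ.+ p))
  (cong -_ (cong₂ _+_ (shiftedBinomialSum-suc β (2 ℕ.+ p)) (shiftedBinomialSum-suc β n))))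
  where
  S₁ S₂ : ℚ
  S₁ = Σ< (2 ℕ.+ p) (λ k → β k * ℕ→ℚ (n C suc k))
  S₂ = Σ< n (λ k → β k * ℕ→ℚ (suc n C suc k))
  halve : ∀ {x y X₁ X₂ : ℚ} → y - x ≡ - ((X₁ + x) + (X₂ + y)) → y ≡ - (½ * (X₁ + X₂))
  halve {x} {y} {X₁} {X₂} eq = sym (begin
    - (½ * (X₁ + X₂))                              ≡⟨ solve 4 (λ x y X₁ X₂ → :- (con ½ :* (X₁ :+ X₂))
                                                        := :- (con ½ :* (:- (:- ((X₁ :+ x) :+ (X₂ :+ y))) :- x :- y)))
                                                        refl x y X₁ X₂ ⟩
    - (½ * (- (- ((X₁ + x) + (X₂ + y))) - x - y))  ≡⟨ cong (λ z → - (½ * (- z - x - y))) eq ⟨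
    - (½ * (- (y - x) - x - y))                    ≡⟨ solve 2 (λ x y → :- (con ½ :* (:- (y :- x) :- x :- y)) := y) refl x y ⟩
    y                                              ∎)
    where open ≡-Reasoning

bG≡β : ∀ n → bG n ≡ β n
bG≡β = bStep-fixpoint-unique bG-fixpoint β-fixpoint

2*[1+m]≡2+[m+m] : ∀ m → 2 ℕ.* suc m ≡ 2 ℕ.+ (m ℕ.+ m)
2*[1+m]≡2+[m+m] m = cong suc (trans (cong (m ℕ.+_) (ℕₚ.+-identityʳ (suc m))) (ℕₚ.+-suc m m))

mainTheorem8 : (n : ℕ) → 1 ℕ.≤ n →
    (derivAt0 (2 ℕ.* n ∸ 1) Gt ≡ 0ℚ) × (derivAt0 (2 ℕ.* n) Gt ≡ bG (2 ℕ.* n ∸ 2))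
mainTheorem8 (suc m) _ = subst (λ j → (Gt⁽ j ∸ 1 ⁾ ≡ 0ℚ) × (Gt⁽ j ⁾ ≡ bG (j ∸ 2))) (sym (2*[1+m]≡2+[m+m] m))
  (Gt⁽odd⁾≡0 m , sym (begin
    bG (m ℕ.+ m)                                   ≡⟨ bG≡β (m ℕ.+ m) ⟩
    Gt⁽ 2 ℕ.+ (m ℕ.+ m) ⁾ + Gt⁽ 3 ℕ.+ (m ℕ.+ m) ⁾  ≡⟨ cong (Gt⁽ 2 ℕ.+ (m ℕ.+ m) ⁾ +_) Gt⁽3+2m⁾≡0 ⟩
    Gt⁽ 2 ℕ.+ (m ℕ.+ m) ⁾ + 0ℚ                     ≡⟨ +-identityʳ _ ⟩
    Gt⁽ 2 ℕ.+ (m ℕ.+ m) ⁾                          ∎))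
  where
  open ≡-Reasoning
  Gt⁽3+2m⁾≡0 : Gt⁽ 3 ℕ.+ (m ℕ.+ m) ⁾ ≡ 0ℚ
  Gt⁽3+2m⁾≡0 = trans (cong (λ j → Gt⁽ 2 ℕ.+ j ⁾) (sym (ℕₚ.+-suc m m))) (Gt⁽odd⁾≡0 (suc m))
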